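{- Let $G$ be a deterministic presentation and let $w\in\mathcal B(X_G)$. Then there is a path in $\hat G$ labeled $w$ if and only if $w$ is not synchronizing for $G$.
   Context: A labeled graph has a finite vertex set $Q_G$, finite edge set, initial/terminal vertex maps and an edge labeling into a finite alphabet; a presentation is an essential labeled graph (every vertex has an incoming and an outgoing edge). Paths are finite sequences of consecutive edges with concatenated labels; each vertex has a length-zero path labeled by the empty word. $G$ is deterministic if no vertex has two outgoing edges with the same label; $q\cdot w$ is then the end of the unique path from $q$ labeled $w$ (if it exists), and $Q_G\cdot w$ is the set of all such $q\cdot w$. A word $w$ is synchronizing for $G$ if $|Q_G\cdot w|=1$. $X_G$ is the set of labels of bi-infinite paths in $G$, and $\mathcal B(X_G)$ the set of finite words appearing in its points. The label product graph $G*G$ has vertex set $Q_G\times Q_G$ and an edge labeled $a$ from $(p_1,p_2)$ to $(q_1,q_2)$ iff $G$ has an edge labeled $a$ from $p_1$ to $q_1$ and one labeled $a$ from $p_2$ to $q_2$. $\hat G$ is the subgraph of $G*G$ induced by the non-diagonal vertices $\{(p,q):p\neq q\}$. -}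

module Defs where

open import Data.Nat using (ℕ)
open import Data.Integer using (ℤ; _+_; +_)
open import Data.Fin using (Fin; toℕ)
open import Data.List using (List; []; _∷_; length; lookup)
open import Data.Product using (Σ; ∃; _×_; _,_; proj₁; proj₂)
open import Function.Bundles using (_↔_)
open import Relation.Binary.PropositionalEquality using (_≡_; _≢_)

record LGraph (A : Set) : Set₁ where
  field
    V    : Set
    E    : Set
    init : E → V
    term : E → V
    lab  : E → A
open LGraph public

IsFinite : Set → Set
IsFinite X = Σ ℕ λ n → X ↔ Fin n

FiniteGraph : {A : Set} → LGraph A → Set
FiniteGraph G = IsFinite (V G) × IsFinite (E G)

Essential : {A : Set} → LGraph A → Set
Essential G = ∀ (v : V G) → (∃ λ e → term G e ≡ v) × (∃ λ e → init G e ≡ v)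

Deterministic : {A : Set} → LGraph A → Set
Deterministic G = ∀ (e₁ e₂ : E G) → init G e₁ ≡ init G e₂ → lab G e₁ ≡ lab G e₂ → e₁ ≡ e₂

data Path {A : Set} (G : LGraph A) : V G → List A → V G → Set where
  nil  : ∀ {p} → Path G p [] p
  cons : ∀ {p w q} (e : E G) → init G e ≡ p → Path G (term G e) w q → Path G p (lab G e ∷ w) q

HasPathLabeled : {A : Set} → LGraph A → List A → Set
HasPathLabeled G w = ∃ λ p → ∃ λ q → Path G p w q

BiInfinitePath : {A : Set} → LGraph A → Set
BiInfinitePath G = Σ (ℤ → E G) λ f → ∀ (i : ℤ) → term G (f i) ≡ init G (f (i + + 1))

InX : {A : Set} → LGraph A → (ℤ → A) → Set
InX G x = Σ (BiInfinitePath G) λ π → ∀ (i : ℤ) → lab G (proj₁ π i) ≡ x i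

OccursIn : {A : Set} → List A → (ℤ → A) → Set
OccursIn w x = ∃ λ (i : ℤ) → ∀ (j : Fin (length w)) → x (i + + toℕ j) ≡ lookup w j

InLanguage : {A : Set} → LGraph A → List A → Set
InLanguage G w = ∃ λ (x : _ → _) → InX G x × OccursIn w x

-- w synchronizing: |Q_G · w| = 1, i.e. Q_G · w = {q} for some q.
Synchronizing : {A : Set} → LGraph A → List A → Set
Synchronizing G w =
  ∃ λ (q : V G) → (∃ λ p → Path G p w q) × (∀ p q' → Path G p w q' → q' ≡ q)

_✶_ : {A : Set} → LGraph A → LGraph A → LGraph A
G ✶ H = record
  { V    = V G × V H
  ; E    = Σ (E G × E H) (λ ee → lab G (proj₁ ee) ≡ lab H (proj₂ ee))
  ; init = λ ee → init G (proj₁ (proj₁ ee)) , init H (proj₂ (proj₁ ee))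
  ; term = λ ee → term G (proj₁ (proj₁ ee)) , term H (proj₂ (proj₁ ee))
  ; lab  = λ ee → lab G (proj₁ (proj₁ ee))
  }

Induced : {A : Set} → (G : LGraph A) → (V G → Set) → LGraph A
Induced G P = record
  { V    = Σ (V G) P
  ; E    = Σ (E G) (λ e → P (init G e) × P (term G e))
  ; init = λ e → init G (proj₁ e) , proj₁ (proj₂ e)
  ; term = λ e → term G (proj₁ e) , proj₂ (proj₂ e)
  ; lab  = λ e → lab G (proj₁ e)
  }

Hat : {A : Set} → LGraph A → LGraph A
Hat G = Induced (G ✶ G) (λ pq → proj₁ pq ≢ proj₂ pq)

{-# OPTIONS --safe #-}
-- A path in Ĝ labeled w is a pair of paths labeled w that never meet; its two
-- endpoints are distinct elements of Q_G · w, so w is not synchronizing.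
-- Conversely, w ∈ B(X_G) makes Q_G · w nonempty, say q₀ ∈ Q_G · w via a path from
-- p₀. If w is not synchronizing, some path labeled w from a vertex p ends at
-- q ≠ q₀ (this existence is decidable because G is finite). By determinism two
-- paths with the same label from the same vertex end at the same vertex, so the
-- two paths from p and p₀ are apart at every step and together form a path in Ĝ.
module Submission where

open import Defs
open import Data.Nat as ℕ using (ℕ)
open import Data.Integer using (ℤ; _+_; +_)
open import Data.Integer.Properties using (+-assoc; +-identityʳ; pos-+)
open import Data.Fin using (Fin; toℕ; zero; suc; _≟_)
open import Data.Fin.Properties using (any?)
open import Data.List using (List; []; _∷_; lookup)
open import Data.Empty using (⊥-elim)
open import Data.Product using (_×_; ∃; _,_; proj₁; proj₂)
open import Function using (_∘_)
open import Function.Bundles using (_⇔_; Inverse; mk⇔)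
open import Function.Properties.Inverse using (↔⇒↣)
open import Relation.Binary.Definitions using (DecidableEquality)
open import Relation.Binary.PropositionalEquality
  using (_≡_; _≢_; refl; sym; trans; cong; subst)
open import Relation.Nullary using (¬_; Dec; yes; no)
open import Relation.Nullary.Decidable using (map′; via-injection; _×-dec_; ¬?; decidable-stable)

module _ {A : Set} (G : LGraph A) where

  cons′ : ∀ {p a w q} (e : E G) → init G e ≡ p → lab G e ≡ a →
          Path G (term G e) w q → Path G p (a ∷ w) q
  cons′ e refl refl P = cons e refl P

  uncons : ∀ {p a w q} → Path G p (a ∷ w) q →
           ∃ λ e → init G e ≡ p × lab G e ≡ a × Path G (term G e) w q
  uncons (cons e refl P) = e , refl , refl , P

  Path-det : Deterministic G → ∀ {p w q q′} → Path G p w q → Path G p w q′ → q ≡ q′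
  Path-det det nil nil = refl
  Path-det det (cons e refl P) P′ with uncons P′
  ... | e′ , init≡ , lab≡ , P″ with det e e′ (sym init≡) (sym lab≡)
  ... | refl = Path-det det P P″

  Path-det-apart : Deterministic G → ∀ {p₁ p₂ w q₁ q₂} →
                   Path G p₁ w q₁ → Path G p₂ w q₂ → q₁ ≢ q₂ → p₁ ≢ p₂
  Path-det-apart det P₁ P₂ q₁≢q₂ refl = q₁≢q₂ (Path-det det P₁ P₂)

  Hat-path : Deterministic G → ∀ {p₁ p₂ w q₁ q₂} →
             Path G p₁ w q₁ → Path G p₂ w q₂ → (p₁≢p₂ : p₁ ≢ p₂) → q₁ ≢ q₂ →
             ∃ λ (q₁≢q₂ : q₁ ≢ q₂) → Path (Hat G) ((p₁ , p₂) , p₁≢p₂) w ((q₁ , q₂) , q₁≢q₂)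
  Hat-path det nil nil p₁≢p₂ _ = p₁≢p₂ , nil
  Hat-path det (cons e₁ refl P₁) P₂′ p₁≢p₂ q₁≢q₂ with uncons P₂′
  ... | e₂ , refl , lab≡ , P₂ =
    let t₁≢t₂ = Path-det-apart det P₁ P₂ q₁≢q₂
        q₁≢q₂′ , P = Hat-path det P₁ P₂ t₁≢t₂ q₁≢q₂
    in q₁≢q₂′ , cons (((e₁ , e₂) , sym lab≡) , p₁≢p₂ , t₁≢t₂) refl P

Induced-path : ∀ {A} {G : LGraph A} {P : V G → Set} {a w b} →
               Path (Induced G P) a w b → Path G (proj₁ a) w (proj₁ b)
Induced-path nil = nil
Induced-path (cons e refl P) = cons (proj₁ e) refl (Induced-path P)

module _ {A : Set} {G H : LGraph A} where

  ✶-path₁ : ∀ {a w b} → Path (G ✶ H) a w b → Path G (proj₁ a) w (proj₁ b)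
  ✶-path₁ nil = nil
  ✶-path₁ (cons ((e , _) , _) refl P) = cons e refl (✶-path₁ P)

  ✶-path₂ : ∀ {a w b} → Path (G ✶ H) a w b → Path H (proj₂ a) w (proj₂ b)
  ✶-path₂ nil = nil
  ✶-path₂ (cons ((_ , e) , lab≡) refl P) = cons′ H e refl (sym lab≡) (✶-path₂ P)

Hat-path⇒¬Synchronizing : ∀ {A} {G : LGraph A} {w} →
                          HasPathLabeled (Hat G) w → ¬ Synchronizing G w
Hat-path⇒¬Synchronizing (_ , ((q₁ , q₂) , q₁≢q₂) , P) (q , _ , all≡q) =
  q₁≢q₂ (trans (all≡q _ _ (✶-path₁ (Induced-path P)))
               (sym (all≡q _ _ (✶-path₂ (Induced-path P)))))

module _ {X : Set} (finite : IsFinite X) where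

  open Inverse (proj₂ finite)

  IsFinite-≟ : DecidableEquality X
  IsFinite-≟ = via-injection (↔⇒↣ (proj₂ finite)) _≟_

  IsFinite-any? : {P : X → Set} → (∀ x → Dec (P x)) → Dec (∃ P)
  IsFinite-any? {P} P? =
    map′ (λ (i , p) → from i , p)
         (λ (x , p) → to x , subst P (sym (strictlyInverseʳ x)) p)
         (any? (P? ∘ from))

module _ {A : Set} (_≟A_ : DecidableEquality A) (G : LGraph A)
         (finV : IsFinite (V G)) (finE : IsFinite (E G)) where

  _≟V_ : DecidableEquality (V G)
  _≟V_ = IsFinite-≟ finV

  Path? : ∀ p w q → Dec (Path G p w q)
  Path? p [] q = map′ (λ { refl → nil }) (λ { nil → refl }) (p ≟V q)
  Path? p (a ∷ w) q =
    map′ (λ (e , init≡ , lab≡ , P) → cons′ G e init≡ lab≡ P) (uncons G)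
         (IsFinite-any? finE λ e →
           (init G e ≟V p) ×-dec (lab G e ≟A a) ×-dec Path? (term G e) w q)

  Path-avoiding? : ∀ w q → Dec (∃ λ p → ∃ λ q′ → Path G p w q′ × q′ ≢ q)
  Path-avoiding? w q = IsFinite-any? finV λ p → IsFinite-any? finV λ q′ →
    Path? p w q′ ×-dec ¬? (q′ ≟V q)

  ¬Synchronizing⇒Hat-path : Deterministic G → ∀ {p₀ w q₀} → Path G p₀ w q₀ →
                            ¬ Synchronizing G w → HasPathLabeled (Hat G) w
  ¬Synchronizing⇒Hat-path det {p₀} {w} {q₀} P₀ ¬sync with Path-avoiding? w q₀
  ... | yes (p , q , P , q≢q₀) =
    let p≢p₀ = Path-det-apart G det P P₀ q≢q₀
    in _ , _ , proj₂ (Hat-path G det P P₀ p≢p₀ q≢q₀)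
  ... | no ¬avoiding = ⊥-elim (¬sync (q₀ , (p₀ , P₀) , all≡q₀))
    where
    all≡q₀ : ∀ p q → Path G p w q → q ≡ q₀
    all≡q₀ p q P = decidable-stable (q ≟V q₀) λ q≢q₀ → ¬avoiding (p , q , P , q≢q₀)

shift-index : ∀ i n → i + + ℕ.suc n ≡ (i + + 1) + + n
shift-index i n = trans (cong (λ m → i + m) (pos-+ 1 n)) (sym (+-assoc i (+ 1) (+ n)))

module _ {A : Set} (G : LGraph A) (f : ℤ → E G)
         (f-linked : ∀ i → term G (f i) ≡ init G (f (i + + 1))) where

  BiInfinitePath-segment : ∀ i w → (∀ j → lab G (f (i + + toℕ j)) ≡ lookup w j) →
                           ∃ λ q → Path G (init G (f i)) w q
  BiInfinitePath-segment i [] _ = _ , nil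
  BiInfinitePath-segment i (a ∷ w) labels =
    let q , P = BiInfinitePath-segment (i + + 1) w λ j →
                  trans (cong (lab G ∘ f) (sym (shift-index i (toℕ j)))) (labels (suc j))
        P′ = subst (λ v → Path G v w q) (sym (f-linked i)) P
        lab≡ = trans (cong (lab G ∘ f) (sym (+-identityʳ i))) (labels zero)
    in q , cons′ G (f i) refl lab≡ P′

InLanguage⇒HasPathLabeled : ∀ {A} (G : LGraph A) {w} → InLanguage G w → HasPathLabeled G w
InLanguage⇒HasPathLabeled G (_ , ((f , f-linked) , lab≡x) , i , occurs) =
  _ , BiInfinitePath-segment G f f-linked i _ λ j → trans (lab≡x _) (occurs j)

lemma3p4 : (k : ℕ) (G : LGraph (Fin k)) → FiniteGraph G → Essential G → Deterministic G →
    (w : List (Fin k)) → InLanguage G w →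
    HasPathLabeled (Hat G) w ⇔ (¬ Synchronizing G w)
lemma3p4 k G (finV , finE) _ det w w∈B with InLanguage⇒HasPathLabeled G w∈B
... | _ , _ , P₀ =
  mk⇔ Hat-path⇒¬Synchronizing (¬Synchronizing⇒Hat-path _≟_ G finV finE det P₀)
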